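{- Let $k\ge 2$ be an integer. If a finite graph $G$ has an acyclic coloring with at most $k$ colors, then $G$ has an equitable partition into $k-1$ induced forests.
   Context: A proper coloring of a graph $G$ is acyclic if every cycle of $G$ contains vertices of at least 3 distinct colors. An equitable partition of $G$ into $m$ parts is a partition of the vertex set of $G$ into $m$ sets $S_1,\dots,S_m$ (some possibly empty) such that $||S_i|-|S_j||\le 1$ for all $i,j$. An equitable partition into $m$ induced forests is an equitable partition into $m$ parts in which each part induces a forest (acyclic graph; the empty graph counts as a forest). -}

module Defs where

open import Data.Nat using (ℕ; zero; suc; _+_; _≤_; _∸_)
open import Data.Fin using (Fin; zero; suc; inject₁; fromℕ; _≟_)
open import Data.List using (List; length; filter)
open import Data.List using () renaming (allFin to allFinL)
open import Data.Product using (Σ; ∃; _×_; _,_)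
open import Relation.Binary.PropositionalEquality using (_≡_; _≢_)
open import Relation.Nullary using (¬_)
open import Function.Definitions using (Injective)
open import Level using (0ℓ)

record Graph (n : ℕ) : Set₁ where
  field
    Adj     : Fin n → Fin n → Set
    symm    : ∀ {u v} → Adj u v → Adj v u
    irrefl  : ∀ {u} → ¬ Adj u u

open Graph public

-- A cycle of length 3 + m: distinct vertices v₀,…,v_{m+2} with v_i v_{i+1}
-- adjacent and v_{m+2} v₀ adjacent.
record Cycle {n : ℕ} (G : Graph n) : Set where
  field
    m      : ℕ
    vtx    : Fin (3 + m) → Fin n
    inj    : Injective _≡_ _≡_ vtx
    step   : (i : Fin (2 + m)) → Adj G (vtx (inject₁ i)) (vtx (suc i))
    close  : Adj G (vtx (fromℕ (2 + m))) (vtx zero)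

open Cycle public

Proper : ∀ {n} (G : Graph n) {k : ℕ} → (Fin n → Fin k) → Set
Proper {n} G c = ∀ (u v : Fin n) → Adj G u v → c u ≢ c v

AcyclicColoring : ∀ {n} (G : Graph n) {k : ℕ} → (Fin n → Fin k) → Set
AcyclicColoring G c =
  Proper G c ×
  ((C : Cycle G) → Σ (Fin (3 + m C)) λ i → Σ (Fin (3 + m C)) λ j → Σ (Fin (3 + m C)) λ l →
     c (vtx C i) ≢ c (vtx C j) × c (vtx C j) ≢ c (vtx C l) × c (vtx C i) ≢ c (vtx C l))

partSize : ∀ {n m} → (Fin n → Fin m) → Fin m → ℕ
partSize {n} p i = length (filter (λ v → p v ≟ i) (allFinL n))

-- Equitable partition into m parts S_i = p⁻¹(i) (some possibly empty).
Equitable : ∀ {n m} → (Fin n → Fin m) → Set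
Equitable {m = m} p = ∀ (i j : Fin m) → partSize p i ≤ suc (partSize p j)

InducesForest : ∀ {n} (G : Graph n) → (Fin n → Set) → Set
InducesForest G P = (C : Cycle G) → ¬ (∀ i → P (vtx C i))

EquitableForestPartition : ∀ {n} (G : Graph n) (m : ℕ) → Set
EquitableForestPartition {n} G m =
  Σ (Fin n → Fin m) λ p → Equitable p × (∀ (i : Fin m) → InducesForest G (λ v → p v ≡ i))

-- With k colours and k − 1 parts, each of size q or q + 1, to fill, the smallest colour class
-- has at most q vertices (it is below the average N / k), while together with the largest
-- other class it has at least the size t of the next part (as t ≤ N / (k − 1)). So one part
-- can consist of the whole smallest class and t minus its size vertices of the largest one;
-- what remains uses k − 1 colours and has to fill k − 2 parts, and we recurse. Every part
-- meets only two colour classes, so by acyclicity of the colouring it induces a forest.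
module Submission where

open import Defs
open import Data.Nat using (ℕ; _≤_; _∸_)
open import Data.Fin using (Fin)
open import Data.Product using (Σ)

open import Data.Bool using (Bool; true; false; _∧_; _∨_; not; if_then_else_)
open import Data.Bool.Properties using (∧-identityʳ; ∧-zeroʳ; ∧-conicalˡ; ∧-conicalʳ)
  renaming (_≟_ to _≟ᵇ_)
open import Data.Empty using (⊥)
open import Data.Fin using (zero; suc; _≟_)
open import Data.List using (List; filter; length; tabulate; allFin)
open import Data.List.Membership.Propositional using (_∈_)
open import Data.List.Membership.Propositional.Properties using (∈-filter⁺; ∈-allFin)
open import Data.List.Relation.Unary.All using (All; lookup)
open import Data.List.Relation.Unary.All.Properties using (all-filter)
open import Data.Nat using (zero; suc; _+_; _*_; z≤n; s≤s; z<s; _≤?_)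
open import Data.Nat.DivMod using (_/_; _%_; m≡m%n+[m/n]*n; m%n<n; m/n*n≤m)
open import Data.Nat.Properties hiding (_≟_)
open import Data.Nat.Tactic.RingSolver using (solve-∀)
open import Data.Product using (∃; ∃₂; _×_; _,_; proj₁; proj₂)
open import Data.Sum as Sum using (_⊎_; inj₁; inj₂; [_,_]′)
open import Data.Vec.Functional using (_∷_)
open import Function using (_∘_)
open import Relation.Binary.PropositionalEquality
open import Relation.Nullary using (Dec; yes; no; does; contradiction)
open import Relation.Nullary.Decidable using (dec-true; dec-false)
open import Algebra.Properties.CommutativeMonoid.Sum +-0-commutativeMonoid
  using (sum-syntax; sum-cong-≗; ∑-distrib-+; ∑-comm; sum-replicate-zero)
open import Algebra.Properties.Semiring.Sum +-*-semiring using (*-distribʳ-sum)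
import Data.List.Extrema ≤-totalOrder as Extrema

does⇒ : ∀ {p} {P : Set p} (P? : Dec P) → does P? ≡ true → P
does⇒ (yes p) _ = p
does⇒ (no _) ()

¬three-distinct-in-pair : ∀ {a} {A : Set a} {x y z u w : A} →
  x ≡ u ⊎ x ≡ w → y ≡ u ⊎ y ≡ w → z ≡ u ⊎ z ≡ w → x ≢ y → y ≢ z → x ≢ z → ⊥
¬three-distinct-in-pair (inj₁ x≡u) (inj₁ y≡u) _ x≢y _ _ = x≢y (trans x≡u (sym y≡u))
¬three-distinct-in-pair (inj₂ x≡w) (inj₂ y≡w) _ x≢y _ _ = x≢y (trans x≡w (sym y≡w))
¬three-distinct-in-pair (inj₁ x≡u) _ (inj₁ z≡u) _ _ x≢z = x≢z (trans x≡u (sym z≡u))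
¬three-distinct-in-pair (inj₂ x≡w) _ (inj₂ z≡w) _ _ x≢z = x≢z (trans x≡w (sym z≡w))
¬three-distinct-in-pair _ (inj₁ y≡u) (inj₁ z≡u) _ y≢z _ = y≢z (trans y≡u (sym z≡u))
¬three-distinct-in-pair _ (inj₂ y≡w) (inj₂ z≡w) _ y≢z _ = y≢z (trans y≡w (sym z≡w))

⟦_⟧ : Bool → ℕ
⟦ b ⟧ = if b then 1 else 0

⟦∧⟧ : ∀ x y → ⟦ x ∧ y ⟧ ≡ ⟦ y ⟧ * ⟦ x ⟧
⟦∧⟧ false y = sym (*-zeroʳ ⟦ y ⟧)
⟦∧⟧ true  y = sym (*-identityʳ ⟦ y ⟧)

⟦∨⟧ : ∀ x y → x ∧ y ≡ false → ⟦ x ∨ y ⟧ ≡ ⟦ x ⟧ + ⟦ y ⟧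
⟦∨⟧ true  false _ = refl
⟦∨⟧ false y     _ = refl

⟦∖⟧ : ∀ x y → (y ≡ true → x ≡ true) → ⟦ x ⟧ ≡ ⟦ y ⟧ + ⟦ x ∧ not y ⟧
⟦∖⟧ x     false _ = cong ⟦_⟧ (sym (∧-identityʳ x))
⟦∖⟧ true  true  _ = refl
⟦∖⟧ false true  y⇒x = contradiction (y⇒x refl) λ ()

⟦⟧≡0⇒false : ∀ {b} → ⟦ b ⟧ ≡ 0 → b ≡ false
⟦⟧≡0⇒false {false} _ = refl

⟦⟧*-mono-≤ : ∀ b {x y} → (b ≡ true → x ≤ y) → ⟦ b ⟧ * x ≤ ⟦ b ⟧ * y
⟦⟧*-mono-≤ true  x≤y = *-monoʳ-≤ 1 (x≤y refl)
⟦⟧*-mono-≤ false _   = z≤n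

∑-mono-≤ : ∀ {k} {f g : Fin k → ℕ} → (∀ i → f i ≤ g i) → ∑[ i < k ] f i ≤ ∑[ i < k ] g i
∑-mono-≤ {zero}  _   = z≤n
∑-mono-≤ {suc k} f≤g = +-mono-≤ (f≤g zero) (∑-mono-≤ (f≤g ∘ suc))

Subset : ℕ → Set
Subset n = Fin n → Bool

module _ {n : ℕ} where

  infixr 7 _∩_
  infixr 6 _∪_ _∖_
  infix  4 _⊆_

  _⊆_ : Subset n → Subset n → Set
  X ⊆ Y = ∀ v → X v ≡ true → Y v ≡ true

  _∩_ _∪_ _∖_ : Subset n → Subset n → Subset n
  (X ∩ Y) v = X v ∧ Y v
  (X ∪ Y) v = X v ∨ Y v
  (X ∖ Y) v = X v ∧ not (Y v)

  ⁅_⁆ : Fin n → Subset n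
  ⁅ a ⁆ x = does (a ≟ x)

  count : Subset n → ℕ
  count X = ∑[ v < n ] ⟦ X v ⟧

  sumOver : Subset n → (Fin n → ℕ) → ℕ
  sumOver A f = ∑[ x < n ] (⟦ A x ⟧ * f x)

  ∪⇒⊎ : ∀ X Y v → (X ∪ Y) v ≡ true → X v ≡ true ⊎ Y v ≡ true
  ∪⇒⊎ X Y v X∪Yv with X v
  ... | true  = inj₁ refl
  ... | false = inj₂ X∪Yv

  ∖⁅⁆⇒≢ : ∀ {A a b} → (A ∖ ⁅ a ⁆) b ≡ true → a ≢ b
  ∖⁅⁆⇒≢ {A} {a} a∈A∖a refl with a ≟ a
  ... | yes _   = contradiction (trans (sym (∧-zeroʳ (A a))) a∈A∖a) λ ()
  ... | no a≢a = a≢a refl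

  ⁅⁆⊆ : ∀ {A a} → A a ≡ true → ⁅ a ⁆ ⊆ A
  ⁅⁆⊆ {A} {a} a∈A x a≟x = subst (λ y → A y ≡ true) (does⇒ (a ≟ x) a≟x) a∈A

  count-cong : ∀ {X Y} → (∀ v → X v ≡ Y v) → count X ≡ count Y
  count-cong X≗Y = sum-cong-≗ (cong ⟦_⟧ ∘ X≗Y)

  count-+ : ∀ {X Y Z} → (∀ v → ⟦ Z v ⟧ ≡ ⟦ X v ⟧ + ⟦ Y v ⟧) → count Z ≡ count X + count Y
  count-+ {X} {Y} h = trans (sum-cong-≗ h) (∑-distrib-+ (⟦_⟧ ∘ X) (⟦_⟧ ∘ Y))

  count-∪ : ∀ {X Y} → (∀ v → X v ∧ Y v ≡ false) → count (X ∪ Y) ≡ count X + count Y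
  count-∪ {X} {Y} disjoint = count-+ λ v → ⟦∨⟧ (X v) (Y v) (disjoint v)

  count-∖ : ∀ {X Y} → Y ⊆ X → count X ≡ count Y + count (X ∖ Y)
  count-∖ {X} {Y} Y⊆X = count-+ λ v → ⟦∖⟧ (X v) (Y v) (Y⊆X v)

  count-empty : ∀ {X} → (∀ v → X v ≡ false) → count X ≡ 0
  count-empty X≗∅ = trans (count-cong X≗∅) (sum-replicate-zero n)

  sumOver-mono-≤ : ∀ A {f g} → (∀ x → A x ≡ true → f x ≤ g x) → sumOver A f ≤ sumOver A g
  sumOver-mono-≤ A f≤g = ∑-mono-≤ λ x → ⟦⟧*-mono-≤ (A x) (f≤g x)

  sumOver-const : ∀ A y → sumOver A (λ _ → y) ≡ count A * y
  sumOver-const A y = sym (*-distribʳ-sum y (⟦_⟧ ∘ A))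

  count*≤sumOver : ∀ A f {y} → (∀ x → A x ≡ true → y ≤ f x) → count A * y ≤ sumOver A f
  count*≤sumOver A f {y} y≤f = subst (_≤ sumOver A f) (sumOver-const A y) (sumOver-mono-≤ A y≤f)

  sumOver≤count* : ∀ A f {y} → (∀ x → A x ≡ true → f x ≤ y) → sumOver A f ≤ count A * y
  sumOver≤count* A f {y} f≤y = subst (sumOver A f ≤_) (sumOver-const A y) (sumOver-mono-≤ A f≤y)

fibre : ∀ {n m} → (Fin n → Fin m) → Fin m → Subset n
fibre f j v = ⁅ f v ⁆ j

count-all : ∀ {n} → count {n} (λ _ → true) ≡ n
count-all {zero}  = refl
count-all {suc n} = cong suc (count-all {n})

count-⁅⁆ : ∀ {n} (a : Fin n) → count ⁅ a ⁆ ≡ 1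
count-⁅⁆ {suc n} zero    = cong suc (sum-replicate-zero n)
count-⁅⁆ {suc n} (suc a) = count-⁅⁆ a

sumOver-⁅⁆ : ∀ {n} (a : Fin n) f → sumOver ⁅ a ⁆ f ≡ f a
sumOver-⁅⁆ {suc n} zero    f =
  trans (cong₂ _+_ (+-identityʳ (f zero)) (sum-replicate-zero n)) (+-identityʳ (f zero))
sumOver-⁅⁆ {suc n} (suc a) f = sumOver-⁅⁆ a (f ∘ suc)

count≡0⇒empty : ∀ {n} {X : Subset n} → count X ≡ 0 → ∀ v → X v ≡ false
count≡0⇒empty {suc n} ∣X∣≡0 zero    = ⟦⟧≡0⇒false (m+n≡0⇒m≡0 _ ∣X∣≡0)
count≡0⇒empty {suc n} ∣X∣≡0 (suc v) = count≡0⇒empty (m+n≡0⇒n≡0 _ ∣X∣≡0) v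

nonempty : ∀ {n} (X : Subset n) {c} → count X ≡ suc c → ∃ λ v → X v ≡ true
nonempty {suc n} X ∣X∣≡1+c with X zero in X₀
... | true  = zero , X₀
... | false = let v , v∈X = nonempty (X ∘ suc) ∣X∣≡1+c in suc v , v∈X

select : ∀ {n} (X : Subset n) t → t ≤ count X → Σ (Subset n) λ T → T ⊆ X × count T ≡ t
select {zero}  X zero    _ = (λ ()) , (λ ()) , refl
select {suc n} X t       t≤∣X∣ with X zero in X₀
select {suc n} X t       t≤∣X∣      | false
  with T , T⊆X , ∣T∣ ← select (X ∘ suc) t t≤∣X∣ =
  (false ∷ T) , (λ { zero () ; (suc v) → T⊆X v }) , ∣T∣
select {suc n} X zero    _          | true =
  (λ _ → false) , (λ _ ()) , count-empty {suc n} {λ _ → false} (λ _ → refl)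
select {suc n} X (suc t) (s≤s t≤∣X∣) | true
  with T , T⊆X , ∣T∣ ← select (X ∘ suc) t t≤∣X∣ =
  (true ∷ T) , (λ { zero _ → X₀ ; (suc v) → T⊆X v }) , cong suc ∣T∣

count-∖⁅⁆ : ∀ {n} (A : Subset n) {a m} → A a ≡ true → count A ≡ suc m → count (A ∖ ⁅ a ⁆) ≡ m
count-∖⁅⁆ A {a} a∈A ∣A∣ = suc-injective (begin
  suc (count (A ∖ ⁅ a ⁆))        ≡⟨ cong (_+ count (A ∖ ⁅ a ⁆)) (count-⁅⁆ a) ⟨
  count ⁅ a ⁆ + count (A ∖ ⁅ a ⁆) ≡⟨ count-∖ (⁅⁆⊆ {A = A} a∈A) ⟨
  count A                         ≡⟨ ∣A∣ ⟩
  suc _                           ∎)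
  where open ≡-Reasoning

sumOver-remove : ∀ {n} (A : Subset n) {a} f → A a ≡ true →
  sumOver A f ≡ f a + sumOver (A ∖ ⁅ a ⁆) f
sumOver-remove A {a} f a∈A = begin
  sumOver A f
    ≡⟨ sum-cong-≗ (λ x → trans (cong (_* f x) (⟦∖⟧ (A x) (⁅ a ⁆ x) (⁅⁆⊆ {A = A} a∈A x)))
                               (*-distribʳ-+ (f x) ⟦ ⁅ a ⁆ x ⟧ _)) ⟩
  ∑[ x < _ ] (⟦ ⁅ a ⁆ x ⟧ * f x + ⟦ (A ∖ ⁅ a ⁆) x ⟧ * f x)
    ≡⟨ ∑-distrib-+ (λ x → ⟦ ⁅ a ⁆ x ⟧ * f x) (λ x → ⟦ (A ∖ ⁅ a ⁆) x ⟧ * f x) ⟩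
  sumOver ⁅ a ⁆ f + sumOver (A ∖ ⁅ a ⁆) f
    ≡⟨ cong (_+ sumOver (A ∖ ⁅ a ⁆) f) (sumOver-⁅⁆ a f) ⟩
  f a + sumOver (A ∖ ⁅ a ⁆) f ∎
  where open ≡-Reasoning

module _ {k} (A : Subset k) (f : Fin k → ℕ) {x₀ : Fin k} (x₀∈A : A x₀ ≡ true) where

  private
    members : List (Fin k)
    members = filter (λ x → A x ≟ᵇ true) (allFin k)

    ∈-members : ∀ {x} → A x ≡ true → x ∈ members
    ∈-members {x} = ∈-filter⁺ (λ x → A x ≟ᵇ true) (∈-allFin x)

    members⊆A : All (λ x → A x ≡ true) members
    members⊆A = all-filter (λ x → A x ≟ᵇ true) (allFin k)

  minimiser : ∃ λ a → A a ≡ true × (∀ x → A x ≡ true → f a ≤ f x)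
  minimiser = Extrema.argmin f x₀ members
            , Extrema.argmin-all f x₀∈A members⊆A
            , λ x x∈A → lookup (Extrema.f[argmin]≤f[xs] x₀ members) (∈-members x∈A)

  maximiser : ∃ λ b → A b ≡ true × (∀ x → A x ≡ true → f x ≤ f b)
  maximiser = Extrema.argmax f x₀ members
            , Extrema.argmax-all f x₀∈A members⊆A
            , λ x x∈A → lookup (Extrema.f[xs]≤f[argmax] x₀ members) (∈-members x∈A)

length-filter-tabulate : ∀ {a p} {A : Set a} {P : A → Set p} (P? : ∀ x → Dec (P x))
  {n} (f : Fin n → A) →
  length (filter P? (tabulate f)) ≡ count (λ v → does (P? (f v)))
length-filter-tabulate P? {zero}  f = refl
length-filter-tabulate P? {suc n} f with does (P? (f zero))
... | true  = cong suc (length-filter-tabulate P? (f ∘ suc))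
... | false = length-filter-tabulate P? (f ∘ suc)

quotient-bounds : ∀ N m → suc m * (N / suc m) ≤ N × N ≤ suc m * suc (N / suc m)
quotient-bounds N m = lower , upper
  where
  q : ℕ
  q = N / suc m
  lower : suc m * q ≤ N
  lower = subst (_≤ N) (*-comm q (suc m)) (m/n*n≤m N (suc m))
  upper : N ≤ suc m * suc q
  upper = begin
    N                     ≡⟨ m≡m%n+[m/n]*n N (suc m) ⟩
    N % suc m + q * suc m ≤⟨ +-monoˡ-≤ (q * suc m) (<⇒≤ (m%n<n N (suc m))) ⟩
    suc q * suc m         ≡⟨ *-comm (suc q) (suc m) ⟩
    suc m * suc q         ∎
    where open ≤-Reasoning

next-part-size : ∀ m q N → suc m * q ≤ N → N ≤ suc m * suc q →
  ∃ λ t → q ≤ t × t ≤ suc q × suc m * t ≤ N × m * q ≤ N ∸ t × N ∸ t ≤ m * suc q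
next-part-size m q N lower upper with N ≤? suc m * q + m
... | yes N≤ = q , ≤-refl , n≤1+n q , lower , m*q≤N∸q , N∸q≤m*[1+q]
  where
  m*q≤N∸q : m * q ≤ N ∸ q
  m*q≤N∸q = m+n≤o⇒m≤o∸n (m * q) (subst (_≤ N) (+-comm q (m * q)) lower)
  N∸q≤m*[1+q] : N ∸ q ≤ m * suc q
  N∸q≤m*[1+q] = m≤n+o⇒m∸n≤o N q (subst (N ≤_) (regroup m q) N≤)
    where
    regroup : ∀ m q → suc m * q + m ≡ q + m * suc q
    regroup = solve-∀
... | no N≰ =
  suc q , n≤1+n q , ≤-refl , ≤-reflexive (sym N≡) , m*q≤N∸[1+q] , ≤-reflexive N∸[1+q]≡
  where
  N≡ : N ≡ suc m * suc q
  N≡ = ≤-antisym upper (subst (_≤ N) (sym (regroup m q)) (≰⇒> N≰))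
    where
    regroup : ∀ m q → suc m * suc q ≡ suc (suc m * q + m)
    regroup = solve-∀
  N∸[1+q]≡ : N ∸ suc q ≡ m * suc q
  N∸[1+q]≡ = trans (cong (_∸ suc q) N≡) (m+n∸m≡n (suc q) (m * suc q))
  m*q≤N∸[1+q] : m * q ≤ N ∸ suc q
  m*q≤N∸[1+q] = subst (m * q ≤_) (sym N∸[1+q]≡) (*-monoʳ-≤ m (n≤1+n q))

[1+m]*x≤m*[1+q]⇒x≤q : ∀ m q x → suc m * x ≤ m * suc q → x ≤ q
[1+m]*x≤m*[1+q]⇒x≤q m q x [1+m]x≤m[1+q] = ≮⇒≥ λ q<x → <-irrefl refl (begin-strict
  m * suc q         <⟨ m<n+m (m * suc q) z<s ⟩
  suc m * suc q     ≤⟨ *-monoʳ-≤ (suc m) q<x ⟩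
  suc m * x         ≤⟨ [1+m]x≤m[1+q] ⟩
  m * suc q         ∎)
  where open ≤-Reasoning

[1+m]*t≤x+[1+m]*y⇒t≤x+y : ∀ m {t x y} → suc m * t ≤ x + suc m * y → t ≤ x + y
[1+m]*t≤x+[1+m]*y⇒t≤x+y m {t} {x} {y} h = *-cancelˡ-≤ (suc m) (begin
  suc m * t             ≤⟨ h ⟩
  x + suc m * y         ≤⟨ +-monoˡ-≤ (suc m * y) (m≤n*m x (suc m)) ⟩
  suc m * x + suc m * y ≡⟨ *-distribˡ-+ (suc m) x y ⟨
  suc m * (x + y)       ∎)
  where open ≤-Reasoning

module Colouring {n k : ℕ} (c : Fin n → Fin k) where

  class : Subset n → Fin k → Subset n
  class S x = S ∩ fibre c x

  TwoColoured : Subset n → Set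
  TwoColoured P = ∃₂ λ a b → ∀ v → P v ≡ true → c v ≡ a ⊎ c v ≡ b

  record Block (q : ℕ) (P : Subset n) : Set where
    field
      lower       : q ≤ count P
      upper       : count P ≤ suc q
      twoColoured : TwoColoured P

  Block-cong : ∀ {q X Y} → (∀ v → X v ≡ Y v) → Block q X → Block q Y
  Block-cong {q} X≗Y record { lower = lower ; upper = upper ; twoColoured = a , b , X⊆ab } = record
    { lower       = subst (q ≤_) (count-cong X≗Y) lower
    ; upper       = subst (_≤ suc q) (count-cong X≗Y) upper
    ; twoColoured = a , b , λ v Yv → X⊆ab v (trans (X≗Y v) Yv)
    }

  class⊆ : ∀ S x → class S x ⊆ S
  class⊆ S x v = ∧-conicalˡ (S v) _

  class-colour : ∀ S x v → class S x v ≡ true → c v ≡ x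
  class-colour S x v v∈Sx = does⇒ (c v ≟ x) (∧-conicalʳ (S v) _ v∈Sx)

  count-by-class : ∀ {S A} → S ⊆ A ∘ c → count S ≡ sumOver A (count ∘ class S)
  count-by-class {S} {A} S⊆A = begin
    count S
      ≡⟨ sum-cong-≗ (λ v → sumOver-⁅⁆ (c v) (λ _ → ⟦ S v ⟧)) ⟨
    ∑[ v < n ] ∑[ x < k ] (⟦ ⁅ c v ⁆ x ⟧ * ⟦ S v ⟧)
      ≡⟨ sum-cong-≗ (λ v → sum-cong-≗ (λ x → ⟦∧⟧ (S v) (⁅ c v ⁆ x))) ⟨
    ∑[ v < n ] ∑[ x < k ] ⟦ class S x v ⟧
      ≡⟨ ∑-comm (λ v x → ⟦ class S x v ⟧) ⟩
    ∑[ x < k ] count (class S x)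
      ≡⟨ sum-cong-≗ empty-outside-A ⟩
    sumOver A (count ∘ class S) ∎
    where
    open ≡-Reasoning
    empty-outside-A : ∀ x → count (class S x) ≡ ⟦ A x ⟧ * count (class S x)
    empty-outside-A x with A x in x∉A
    ... | true  = sym (+-identityʳ _)
    ... | false = count-empty not-in-class
      where
      not-in-class : ∀ v → class S x v ≡ false
      not-in-class v with S v in v∈S
      ... | false = refl
      ... | true  = dec-false (c v ≟ x) λ cv≡x →
        contradiction (trans (sym (S⊆A v v∈S)) (trans (cong A cv≡x) x∉A)) λ ()

  class⊆⇒∖⊆colours∖⁅⁆ : ∀ {S P A a} → S ⊆ A ∘ c → class S a ⊆ P → S ∖ P ⊆ (A ∖ ⁅ a ⁆) ∘ c
  class⊆⇒∖⊆colours∖⁅⁆ {S} {P} {A} {a} S⊆A Sa⊆P v v∈S∖P with S v in v∈S | P v in v∈P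
  ... | false | _     = contradiction v∈S∖P λ ()
  ... | true  | true  = contradiction v∈S∖P λ ()
  ... | true  | false = cong₂ (λ x y → x ∧ not y) (S⊆A v v∈S) (dec-false (a ≟ c v) λ a≡cv →
      contradiction (trans (sym (Sa⊆P v (cong₂ _∧_ v∈S (dec-true (c v ≟ a) (sym a≡cv))))) v∈P)
                    λ ())

  -- Opaque: unfolding these constructions while checking `peel` exhausts memory.
  opaque
    joinClasses : ∀ S {a b} t → a ≢ b →
      count (class S a) ≤ t → t ≤ count (class S a) + count (class S b) →
      Σ (Subset n) λ P → P ⊆ S × class S a ⊆ P × count P ≡ t × TwoColoured P
    joinClasses S {a} {b} t a≢b ∣Sa∣≤t t≤∣Sa∣+∣Sb∣
      with T , T⊆Sb , ∣T∣ ←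
             select (class S b) (t ∸ count (class S a)) (m≤n+o⇒m∸n≤o t _ t≤∣Sa∣+∣Sb∣) =
      class S a ∪ T
      , (λ v v∈P → [ class⊆ S a v , class⊆ S b v ∘ T⊆Sb v ]′ (∪⇒⊎ (class S a) T v v∈P))
      , (λ v v∈Sa → cong (_∨ T v) v∈Sa)
      , trans (count-∪ disjoint) (trans (cong (count (class S a) +_) ∣T∣) (m+[n∸m]≡n ∣Sa∣≤t))
      , a , b , (λ v v∈P →
          Sum.map (class-colour S a v) (class-colour S b v ∘ T⊆Sb v) (∪⇒⊎ (class S a) T v v∈P))
      where
      disjoint : ∀ v → class S a v ∧ T v ≡ false
      disjoint v with T v in v∈T
      ... | false = ∧-zeroʳ (class S a v)
      ... | true  = begin
        (S v ∧ does (c v ≟ a)) ∧ true ≡⟨ ∧-identityʳ _ ⟩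
        S v ∧ does (c v ≟ a)          ≡⟨ cong (S v ∧_) (dec-false (c v ≟ a) c[v]≢a) ⟩
        S v ∧ false                   ≡⟨ ∧-zeroʳ (S v) ⟩
        false                         ∎
        where
        open ≡-Reasoning
        c[v]≢a : c v ≢ a
        c[v]≢a cv≡a = a≢b (trans (sym cv≡a) (class-colour S b v (T⊆Sb v v∈T)))

    -- a is a smallest colour class of S, and b a largest one among the other colours.
    extremeClasses : ∀ {m S} A → count A ≡ suc (suc m) → S ⊆ A ∘ c →
      ∃₂ λ a b → A a ≡ true × (A ∖ ⁅ a ⁆) b ≡ true ×
        suc (suc m) * count (class S a) ≤ count S ×
        count S ≤ count (class S a) + suc m * count (class S b)
    extremeClasses {m} {S} A ∣A∣ S⊆A
      with a , a∈A , a-min ← minimiser A (count ∘ class S) (proj₂ (nonempty A ∣A∣))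
      with b , b∈A∖a , b-max ←
             maximiser (A ∖ ⁅ a ⁆) (count ∘ class S)
               (proj₂ (nonempty (A ∖ ⁅ a ⁆) (count-∖⁅⁆ A a∈A ∣A∣)))
      = a , b , a∈A , b∈A∖a , small , large
      where
      size : Fin k → ℕ
      size = count ∘ class S
      small : suc (suc m) * size a ≤ count S
      small = begin
        suc (suc m) * size a ≡⟨ cong (_* size a) ∣A∣ ⟨
        count A * size a     ≤⟨ count*≤sumOver A size a-min ⟩
        sumOver A size       ≡⟨ count-by-class {A = A} S⊆A ⟨
        count S              ∎
        where open ≤-Reasoning
      large : count S ≤ size a + suc m * size b
      large = begin
        count S                              ≡⟨ count-by-class {A = A} S⊆A ⟩
        sumOver A size                       ≡⟨ sumOver-remove A size a∈A ⟩
        size a + sumOver (A ∖ ⁅ a ⁆) size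
          ≤⟨ +-monoʳ-≤ (size a) (sumOver≤count* (A ∖ ⁅ a ⁆) size b-max) ⟩
        size a + count (A ∖ ⁅ a ⁆) * size b
          ≡⟨ cong (λ z → size a + z * size b) (count-∖⁅⁆ A a∈A ∣A∣) ⟩
        size a + suc m * size b              ∎
        where open ≤-Reasoning

  record Peeled (m q : ℕ) (S : Subset n) : Set where
    field
      part          : Subset n
      part⊆S        : part ⊆ S
      block         : Block q part
      colours       : Subset k
      count-colours : count colours ≡ suc m
      rest⊆colours  : S ∖ part ⊆ colours ∘ c
      rest-lower    : m * q ≤ count (S ∖ part)
      rest-upper    : count (S ∖ part) ≤ m * suc q

  peel : ∀ {m q S} A → count A ≡ suc (suc m) → S ⊆ A ∘ c →
    suc m * q ≤ count S → count S ≤ suc m * suc q → Peeled m q S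
  peel {m} {q} {S} A ∣A∣ S⊆A lower upper =
    let a , b , a∈A , b∈A∖a , small , large = extremeClasses A ∣A∣ S⊆A
        t , q≤t , t≤1+q , [1+m]t≤N , N∸t-lower , N∸t-upper = next-part-size m q (count S) lower upper
        ∣Sa∣≤t : count (class S a) ≤ t
        ∣Sa∣≤t = ≤-trans ([1+m]*x≤m*[1+q]⇒x≤q (suc m) q (count (class S a)) (≤-trans small upper))
                         q≤t
        t≤∣Sa∣+∣Sb∣ : t ≤ count (class S a) + count (class S b)
        t≤∣Sa∣+∣Sb∣ = [1+m]*t≤x+[1+m]*y⇒t≤x+y m {x = count (class S a)} {count (class S b)}
                        (≤-trans [1+m]t≤N large)
        P , P⊆S , Sa⊆P , ∣P∣ , twoColoured =
          joinClasses S t (∖⁅⁆⇒≢ {A = A} b∈A∖a) ∣Sa∣≤t t≤∣Sa∣+∣Sb∣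
        ∣S∖P∣ : count (S ∖ P) ≡ count S ∸ t
        ∣S∖P∣ = trans (sym (m+n∸m≡n (count P) (count (S ∖ P))))
                      (cong₂ _∸_ (sym (count-∖ P⊆S)) ∣P∣)
    in record
      { part          = P
      ; part⊆S        = P⊆S
      ; block         = record
        { lower       = subst (q ≤_) (sym ∣P∣) q≤t
        ; upper       = subst (_≤ suc q) (sym ∣P∣) t≤1+q
        ; twoColoured = twoColoured
        }
      ; colours       = A ∖ ⁅ a ⁆
      ; count-colours = count-∖⁅⁆ A a∈A ∣A∣
      ; rest⊆colours  = class⊆⇒∖⊆colours∖⁅⁆ {A = A} S⊆A Sa⊆P
      ; rest-lower    = subst (m * q ≤_) (sym ∣S∖P∣) N∸t-lower
      ; rest-upper    = subst (_≤ m * suc q) (sym ∣S∖P∣) N∸t-upper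
      }

  Partition : ℕ → ℕ → Subset n → Set
  Partition M q S = Σ (Fin n → Fin M) λ p → ∀ j → Block q (S ∩ fibre p j)

  singlePartition : ∀ {q S} → Block q S → Partition 1 q S
  singlePartition B = (λ _ → zero) , λ { zero → Block-cong (λ v → sym (∧-identityʳ _)) B }

  extendPartition : ∀ {M q S P} → P ⊆ S → Block q P → Partition M q (S ∖ P) → Partition (suc M) q S
  extendPartition {S = S} {P} P⊆S B (p , blocks) = p⁺ , λ
    { zero    → Block-cong (λ v → new-part (S v) (P v) (p v) (P⊆S v)) B
    ; (suc j) → Block-cong (λ v → old-part (S v) (P v) (p v) j) (blocks j)
    }
    where
    p⁺ : Fin n → Fin (suc _)
    p⁺ v = if P v then zero else suc (p v)
    new-part : ∀ s b (x : Fin _) → (b ≡ true → s ≡ true) →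
      b ≡ s ∧ does ((if b then zero else suc x) ≟ zero)
    new-part s     false x _   = sym (∧-zeroʳ s)
    new-part true  true  x _   = refl
    new-part false true  x b⇒s = contradiction (b⇒s refl) λ ()
    old-part : ∀ s b (x j : Fin _) →
      (s ∧ not b) ∧ does (x ≟ j) ≡ s ∧ does ((if b then zero else suc x) ≟ suc j)
    old-part false b     x j = refl
    old-part true  true  x j = refl
    old-part true  false x j = refl

  greedyPartition : ∀ m {q S} A → count A ≡ suc (suc m) → S ⊆ A ∘ c →
    suc m * q ≤ count S → count S ≤ suc m * suc q → Partition (suc m) q S
  greedyPartition zero {S = S} A ∣A∣ S⊆A lower upper = singlePartition (Block-cong P≗S block)
    where
    open Peeled (peel A ∣A∣ S⊆A lower upper)
    S∖P≗∅ : ∀ v → (S ∖ part) v ≡ false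
    S∖P≗∅ = count≡0⇒empty (n≤0⇒n≡0 rest-upper)
    P≗S : ∀ v → part v ≡ S v
    P≗S v with S v in v∈S | part v in v∈P
    ... | true  | true  = refl
    ... | false | false = refl
    ... | false | true  = contradiction (trans (sym (part⊆S v v∈P)) v∈S) λ ()
    ... | true  | false =
      contradiction (trans (sym (S∖P≗∅ v)) (cong₂ (λ s p → s ∧ not p) v∈S v∈P)) λ ()
  greedyPartition (suc m) A ∣A∣ S⊆A lower upper =
    extendPartition part⊆S block
      (greedyPartition m colours count-colours rest⊆colours rest-lower rest-upper)
    where open Peeled (peel A ∣A∣ S⊆A lower upper)

  twoColoured⇒forest : ∀ {G : Graph n} → AcyclicColoring G c →
    ∀ {X} → TwoColoured X → InducesForest G (λ v → X v ≡ true)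
  twoColoured⇒forest (_ , acyclic) (a , b , X⊆ab) C C⊆X
    with i , j , l , ci≢cj , cj≢cl , ci≢cl ← acyclic C
    = ¬three-distinct-in-pair (X⊆ab _ (C⊆X i)) (X⊆ab _ (C⊆X j)) (X⊆ab _ (C⊆X l))
        ci≢cj cj≢cl ci≢cl

theorem4 : (k : ℕ) → 2 ≤ k → {n : ℕ} → (G : Graph n) →
    Σ (Fin n → Fin k) (AcyclicColoring G) →
    EquitableForestPartition G (k ∸ 1)
theorem4 (suc zero) (s≤s ()) _ _
theorem4 (suc (suc m)) _ {n} G (c , acyclic) = p , equitable , forest
  where
  open Colouring c
  q : ℕ
  q = n / suc m
  partition : Partition (suc m) q (λ _ → true)
  partition = greedyPartition m (λ _ → true) count-all (λ _ _ → refl)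
    (subst (suc m * q ≤_) (sym count-all) (proj₁ (quotient-bounds n m)))
    (subst (_≤ suc m * suc q) (sym count-all) (proj₂ (quotient-bounds n m)))
  p : Fin n → Fin (suc m)
  p = proj₁ partition
  block : ∀ i → Block q (fibre p i)
  block = proj₂ partition
  partSize≡ : ∀ i → partSize p i ≡ count (fibre p i)
  partSize≡ i = length-filter-tabulate (λ v → p v ≟ i) (λ v → v)
  equitable : Equitable p
  equitable i j = subst₂ (λ x y → x ≤ suc y) (sym (partSize≡ i)) (sym (partSize≡ j))
    (≤-trans (Block.upper (block i)) (s≤s (Block.lower (block j))))
  forest : ∀ i → InducesForest G (λ v → p v ≡ i)
  forest i C C⊆i =
    twoColoured⇒forest acyclic (Block.twoColoured (block i)) C
      (λ l → dec-true (p (vtx C l) ≟ i) (C⊆i l))
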